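{- Let $\mathbf{A}$ be a De Morgan monoid that is finitely subdirectly irreducible and not idempotent. Then $$A=(\neg(f^2)]\;\cup\;[\neg(f^2),f^2]\;\cup\;[f^2),$$ where the interval $[\neg(f^2),f^2]=\{x\in A:\neg(f^2)\leqslant x\leqslant f^2\}$ is the universe of a subalgebra of $\mathbf{A}$, and the sets $(\neg(f^2)]=\{x\in A: x\leqslant \neg(f^2)\}$ and $[f^2)=\{x\in A: f^2\leqslant x\}$ are chains (totally ordered subsets) consisting of idempotent elements.
   Context: An involutive (commutative) residuated lattice (IRL) is an algebra $\mathbf{A}=\langle A;\cdot,\wedge,\vee,\neg,e\rangle$ such that $\langle A;\cdot,e\rangle$ is a commutative monoid, $\langle A;\wedge,\vee\rangle$ is a lattice with order $\leqslant$, $\neg\neg x=x$, and $x\cdot y\leqslant z \iff \neg z\cdot y\leqslant \neg x$ for all $x,y,z$. One writes $f:=\neg e$, $x\to y:=\neg(x\cdot\neg y)$, $x^2:=x\cdot x$. It is square-increasing if $x\leqslant x^2$ for all $x$. A De Morgan monoid is a square-increasing IRL whose lattice reduct is distributive. An element $a$ is idempotent if $a^2=a$; an algebra is idempotent if all its elements are. An algebra is finitely subdirectly irreducible (FSI) if its identity relation is meet-irreducible in its congruence lattice (trivial algebras count as FSI). A subalgebra is taken in the full signature $\cdot,\wedge,\vee,\neg,e$. -}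

module Defs where

open import Level using (0ℓ)
open import Data.Product using (_×_; Σ)
open import Data.Sum using (_⊎_)
open import Relation.Binary.PropositionalEquality using (_≡_)
open import Relation.Binary.Structures using (IsEquivalence)
open import Algebra.Structures using (IsCommutativeMonoid)
open import Algebra.Lattice.Structures using (IsDistributiveLattice)
open import Function.Bundles using (_⇔_)

record DeMorganMonoid : Set₁ where
  infixl 7 _·_
  infixr 6 _∧_
  infixr 5 _∨_
  field
    Carrier : Set
    _·_ : Carrier → Carrier → Carrier
    _∧_ : Carrier → Carrier → Carrier
    _∨_ : Carrier → Carrier → Carrier
    ¬_  : Carrier → Carrier
    e   : Carrier
    isCommutativeMonoid   : IsCommutativeMonoid {A = Carrier} _≡_ _·_ e
    isDistributiveLattice : IsDistributiveLattice {A = Carrier} _≡_ _∨_ _∧_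

  infix 4 _≤_
  _≤_ : Carrier → Carrier → Set
  x ≤ y = x ∧ y ≡ x

  field
    ¬-involutive  : ∀ x → ¬ (¬ x) ≡ x
    residuation   : ∀ x y z → (x · y ≤ z) ⇔ (¬ z · y ≤ ¬ x)
    square-incr   : ∀ x → x ≤ x · x

  f : Carrier
  f = ¬ e

  _² : Carrier → Carrier
  x ² = x · x

  IsIdempotentElem : Carrier → Set
  IsIdempotentElem x = x · x ≡ x

  IsIdempotentAlg : Set
  IsIdempotentAlg = ∀ x → IsIdempotentElem x

  record IsCongruence (θ : Carrier → Carrier → Set) : Set where
    field
      isEquivalence : IsEquivalence θ
      ·-cong : ∀ {x y u v} → θ x y → θ u v → θ (x · u) (y · v)
      ∧-cong : ∀ {x y u v} → θ x y → θ u v → θ (x ∧ u) (y ∧ v)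
      ∨-cong : ∀ {x y u v} → θ x y → θ u v → θ (x ∨ u) (y ∨ v)
      ¬-cong : ∀ {x y} → θ x y → θ (¬ x) (¬ y)

  IsIdentityRel : (Carrier → Carrier → Set) → Set
  IsIdentityRel θ = ∀ x y → θ x y → x ≡ y

  -- finitely subdirectly irreducible: the identity congruence is
  -- meet-irreducible in the congruence lattice
  IsFSI : Set₁
  IsFSI = ∀ (θ φ : Carrier → Carrier → Set) → IsCongruence θ → IsCongruence φ →
          IsIdentityRel (λ x y → θ x y × φ x y) → IsIdentityRel θ ⊎ IsIdentityRel φ

  IsSubuniverse : (Carrier → Set) → Set
  IsSubuniverse S = S e
                  × (∀ x y → S x → S y → S (x · y))
                  × (∀ x y → S x → S y → S (x ∧ y))
                  × (∀ x y → S x → S y → S (x ∨ y))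
                  × (∀ x → S x → S (¬ x))

  IsChain : (Carrier → Set) → Set
  IsChain S = ∀ x y → S x → S y → (x ≤ y ⊎ y ≤ x)

module Submission where

-- If a ∨ b = e,
--    the kernels for a and b meet in the identity, so in an FSI algebra
--    one of a, b equals e: e is join-irreducible.  Applied to
--    e ≤ b ∨ ∼b this gives the dichotomy  e ≤ b  or  b ≤ f.
--  * Elements below ∼f² absorb f, elements above f² absorb f and are
--    idempotent; with the dichotomy, every element above f² is
--    comparable with every element of A.
--  * Non-idempotency forces e ≤ f², so [∼f², f²] contains e and is a
--    subuniverse.  The theorem then collects these facts; the two chains
--    are mapped onto each other by ∼.

open import Defs
open import Level using (0ℓ)
open import Axiom.ExcludedMiddle using (ExcludedMiddle)
open import Data.Product using (_×_; _,_)
open import Data.Sum using (_⊎_; inj₁; inj₂; swap; [_,_]′) renaming (map to ⊎-map)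
open import Data.Empty using (⊥-elim)
open import Relation.Nullary using (¬_)
open import Relation.Binary.PropositionalEquality
  using (_≡_; refl; sym; trans; cong; cong₂; isEquivalence)
open import Relation.Binary.Structures using (IsPartialOrder)
open import Relation.Binary.Bundles using (Poset)
import Relation.Binary.Lattice as OrderLattice
import Relation.Binary.Reasoning.PartialOrder as PartialOrderReasoning
open import Algebra.Structures using (IsCommutativeMonoid)
open import Algebra.Lattice.Bundles using (Lattice)
open import Algebra.Lattice.Structures using (IsDistributiveLattice)
import Algebra.Lattice.Properties.Lattice as LatticeProperties
open import Function.Base using (id)
open import Function.Bundles using (Equivalence)

module Properties (A : DeMorganMonoid) where
  open DeMorganMonoid A renaming (¬_ to ∼_)
  open IsCommutativeMonoid isCommutativeMonoid using (assoc; comm; identityˡ; identityʳ)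
  open IsDistributiveLattice isDistributiveLattice using (isLattice; ∧-distribˡ-∨)

  -- The lattice order.  The library's order-theoretic lattice uses
  -- x ≡ x ∧ y, which is our x ≤ y read backwards; its partial-order and
  -- bound laws are transported along sym.

  lattice : Lattice 0ℓ 0ℓ
  lattice = record { isLattice = isLattice }

  private
    module L = OrderLattice.Lattice (LatticeProperties.∨-∧-orderTheoreticLattice lattice)

  ≤-isPartialOrder : IsPartialOrder _≡_ _≤_
  ≤-isPartialOrder = record
    { isPreorder = record
      { isEquivalence = isEquivalence
      ; reflexive     = λ x≡y → sym (L.reflexive x≡y)
      ; trans         = λ x≤y y≤z → sym (L.trans (sym x≤y) (sym y≤z))
      }
    ; antisym = λ x≤y y≤x → L.antisym (sym x≤y) (sym y≤x)
    }

  ≤-poset : Poset 0ℓ 0ℓ 0ℓ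
  ≤-poset = record { isPartialOrder = ≤-isPartialOrder }

  open Poset ≤-poset public using ()
    renaming (refl to ≤-refl; reflexive to ≡⇒≤; trans to ≤-trans; antisym to ≤-antisym)

  ∧-lowerˡ : ∀ {x y} → x ∧ y ≤ x
  ∧-lowerˡ {x} {y} = sym (L.x∧y≤x x y)

  ∧-lowerʳ : ∀ {x y} → x ∧ y ≤ y
  ∧-lowerʳ {x} {y} = sym (L.x∧y≤y x y)

  ∧-greatest : ∀ {x y z} → z ≤ x → z ≤ y → z ≤ x ∧ y
  ∧-greatest z≤x z≤y = sym (L.∧-greatest (sym z≤x) (sym z≤y))

  ∨-upperˡ : ∀ {x y} → x ≤ x ∨ y
  ∨-upperˡ {x} {y} = sym (L.x≤x∨y x y)

  ∨-upperʳ : ∀ {x y} → y ≤ x ∨ y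
  ∨-upperʳ {x} {y} = sym (L.y≤x∨y x y)

  ∨-least : ∀ {x y z} → x ≤ z → y ≤ z → x ∨ y ≤ z
  ∨-least x≤z y≤z = sym (L.∨-least (sym x≤z) (sym y≤z))

  open PartialOrderReasoning ≤-poset

  residuate : ∀ {x y z} → x · y ≤ z → ∼ z · y ≤ ∼ x
  residuate {x} {y} {z} = Equivalence.to (residuation x y z)

  unresiduate : ∀ {x y z} → ∼ z · y ≤ ∼ x → x · y ≤ z
  unresiduate {x} {y} {z} = Equivalence.from (residuation x y z)

  ∼-antitone : ∀ {x y} → x ≤ y → ∼ y ≤ ∼ x
  ∼-antitone {x} {y} x≤y = begin
    ∼ y      ≡⟨ identityʳ (∼ y) ⟨
    ∼ y · e  ≤⟨ residuate (begin x · e ≡⟨ identityʳ x ⟩ x ≤⟨ x≤y ⟩ y ∎) ⟩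
    ∼ x      ∎

  ∼-reflects : ∀ {x y} → ∼ y ≤ ∼ x → x ≤ y
  ∼-reflects {x} {y} ∼y≤∼x = begin
    x        ≡⟨ ¬-involutive x ⟨
    ∼ (∼ x)  ≤⟨ ∼-antitone ∼y≤∼x ⟩
    ∼ (∼ y)  ≡⟨ ¬-involutive y ⟩
    y        ∎

  ≤∼-swap : ∀ {x y} → x ≤ ∼ y → y ≤ ∼ x
  ≤∼-swap {x} {y} x≤∼y = ∼-reflects (begin ∼ (∼ x) ≡⟨ ¬-involutive x ⟩ x ≤⟨ x≤∼y ⟩ ∼ y ∎)

  ∼≤-swap : ∀ {x y} → ∼ x ≤ y → ∼ y ≤ x
  ∼≤-swap {x} {y} ∼x≤y = ∼-reflects (begin ∼ x ≤⟨ ∼x≤y ⟩ y ≡⟨ ¬-involutive y ⟨ ∼ (∼ y) ∎)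

  ·-monoˡ : ∀ {x x' y} → x ≤ x' → x · y ≤ x' · y
  ·-monoˡ {x} {x'} {y} x≤x' = unresiduate (begin
    ∼ (x' · y) · y  ≤⟨ residuate ≤-refl ⟩
    ∼ x'            ≤⟨ ∼-antitone x≤x' ⟩
    ∼ x             ∎)

  ·-monoʳ : ∀ {x y y'} → y ≤ y' → x · y ≤ x · y'
  ·-monoʳ {x} {y} {y'} y≤y' = begin
    x · y   ≡⟨ comm x y ⟩
    y · x   ≤⟨ ·-monoˡ y≤y' ⟩
    y' · x  ≡⟨ comm y' x ⟩
    x · y'  ∎

  ·-mono : ∀ {x x' y y'} → x ≤ x' → y ≤ y' → x · y ≤ x' · y'
  ·-mono x≤x' y≤y' = ≤-trans (·-monoˡ x≤x') (·-monoʳ y≤y')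

  ·≤f⇒≤∼ : ∀ {x y} → x · y ≤ f → y ≤ ∼ x
  ·≤f⇒≤∼ {x} {y} xy≤f = begin
    y        ≡⟨ identityˡ y ⟨
    e · y    ≡⟨ cong (_· y) (¬-involutive e) ⟨
    ∼ f · y  ≤⟨ residuate xy≤f ⟩
    ∼ x      ∎

  ≤∼⇒·≤f : ∀ {x y} → y ≤ ∼ x → x · y ≤ f
  ≤∼⇒·≤f {x} {y} y≤∼x = unresiduate (begin
    ∼ f · y  ≡⟨ cong (_· y) (¬-involutive e) ⟩
    e · y    ≡⟨ identityˡ y ⟩
    y        ≤⟨ y≤∼x ⟩
    ∼ x      ∎)

  -- Multiplication, being residuated, distributes over joins.
  ·-distribʳ-∨ : ∀ x y z → (y ∨ z) · x ≡ y · x ∨ z · x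
  ·-distribʳ-∨ x y z = ≤-antisym
    (unresiduate (≤-trans (∧-greatest (residuate ∨-upperˡ) (residuate ∨-upperʳ)) ∼∧∼≤∼∨))
    (∨-least (·-monoˡ ∨-upperˡ) (·-monoˡ ∨-upperʳ))
    where
    ∼∧∼≤∼∨ : ∼ y ∧ ∼ z ≤ ∼ (y ∨ z)
    ∼∧∼≤∼∨ = ≤∼-swap (∨-least (≤∼-swap ∧-lowerˡ) (≤∼-swap ∧-lowerʳ))

  ·-distribˡ-∨ : ∀ x y z → x · (y ∨ z) ≡ x · y ∨ x · z
  ·-distribˡ-∨ x y z = begin-equality
    x · (y ∨ z)    ≡⟨ comm x (y ∨ z) ⟩
    (y ∨ z) · x    ≡⟨ ·-distribʳ-∨ x y z ⟩
    y · x ∨ z · x  ≡⟨ cong₂ _∨_ (comm y x) (comm z x) ⟩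
    x · y ∨ x · z  ∎

  below-e-shrinks : ∀ {c y} → c ≤ e → c · y ≤ y
  below-e-shrinks {c} {y} c≤e = begin c · y ≤⟨ ·-monoˡ c≤e ⟩ e · y ≡⟨ identityˡ y ⟩ y ∎

  below-e-idempotent : ∀ {c} → c ≤ e → c · c ≡ c
  below-e-idempotent {c} c≤e = ≤-antisym (below-e-shrinks c≤e) (square-incr c)

  ker : Carrier → Carrier → Carrier → Set
  ker c x y = c · x ≡ c · y

  ker-·ˡ : ∀ {c x y} u → ker c x y → ker c (x · u) (y · u)
  ker-·ˡ {c} {x} {y} u cx≡cy = begin-equality
    c · (x · u)  ≡⟨ assoc c x u ⟨
    c · x · u    ≡⟨ cong (_· u) cx≡cy ⟩
    c · y · u    ≡⟨ assoc c y u ⟩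
    c · (y · u)  ∎

  ker-·ʳ : ∀ {c u v} y → ker c u v → ker c (y · u) (y · v)
  ker-·ʳ {c} {u} {v} y cu≡cv = begin-equality
    c · (y · u)  ≡⟨ cong (c ·_) (comm y u) ⟩
    c · (u · y)  ≡⟨ ker-·ˡ y cu≡cv ⟩
    c · (v · y)  ≡⟨ cong (c ·_) (comm v y) ⟩
    c · (y · v)  ∎

  module _ {c : Carrier} (c≤e : c ≤ e) where

    absorb-bound : ∀ {z w} → c · z ≤ w → c · z ≤ c · w
    absorb-bound {z} {w} cz≤w = begin
      c · z        ≡⟨ cong (_· z) (below-e-idempotent c≤e) ⟨
      c · c · z    ≡⟨ assoc c c z ⟩
      c · (c · z)  ≤⟨ ·-monoʳ cz≤w ⟩
      c · w        ∎

    ker-bound : ∀ {x y} → ker c x y → c · x ≤ y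
    ker-bound {x} {y} cx≡cy = begin c · x ≡⟨ cx≡cy ⟩ c · y ≤⟨ below-e-shrinks c≤e ⟩ y ∎

    -- For c ≤ e, compatibility with ∧ and ∼ (each one inequality).
    ker-∧ : ∀ {x y u v} → ker c x y → ker c u v → c · (x ∧ u) ≤ c · (y ∧ v)
    ker-∧ cx≡cy cu≡cv = absorb-bound (∧-greatest
      (≤-trans (·-monoʳ ∧-lowerˡ) (ker-bound cx≡cy))
      (≤-trans (·-monoʳ ∧-lowerʳ) (ker-bound cu≡cv)))

    ker-∼ : ∀ {x y} → ker c x y → c · ∼ y ≤ c · ∼ x
    ker-∼ {x} {y} cx≡cy = absorb-bound (begin
      c · ∼ y  ≡⟨ comm c (∼ y) ⟩
      ∼ y · c  ≤⟨ residuate (≤-trans (≡⇒≤ (comm x c)) (ker-bound cx≡cy)) ⟩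
      ∼ x      ∎)

    ker-isCongruence : IsCongruence (ker c)
    ker-isCongruence = record
      { isEquivalence = record { refl = refl ; sym = sym ; trans = trans }
      ; ·-cong = λ {x} {y} {u} {v} cx≡cy cu≡cv → trans (ker-·ˡ u cx≡cy) (ker-·ʳ y cu≡cv)
      ; ∧-cong = λ cx≡cy cu≡cv → ≤-antisym (ker-∧ cx≡cy cu≡cv) (ker-∧ (sym cx≡cy) (sym cu≡cv))
      ; ∨-cong = λ {x} {y} {u} {v} cx≡cy cu≡cv →
          trans (·-distribˡ-∨ c x u) (trans (cong₂ _∨_ cx≡cy cu≡cv) (sym (·-distribˡ-∨ c y v)))
      ; ¬-cong = λ cx≡cy → ≤-antisym (ker-∼ (sym cx≡cy)) (ker-∼ cx≡cy)
      }

    ker-identity⇒e : IsIdentityRel (ker c) → c ≡ e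
    ker-identity⇒e identity = identity c e (trans (below-e-idempotent c≤e) (sym (identityʳ c)))

  -- If a ∨ b = e, then x is recovered from a · x and b · x, so the two
  -- kernels meet in the identity.
  ker-meet-identity : ∀ {a b} → a ∨ b ≡ e → IsIdentityRel (λ x y → ker a x y × ker b x y)
  ker-meet-identity {a} {b} a∨b≡e x y (ax≡ay , bx≡by) = begin-equality
    x              ≡⟨ identityˡ x ⟨
    e · x          ≡⟨ cong (_· x) a∨b≡e ⟨
    (a ∨ b) · x    ≡⟨ ·-distribʳ-∨ x a b ⟩
    a · x ∨ b · x  ≡⟨ cong₂ _∨_ ax≡ay bx≡by ⟩
    a · y ∨ b · y  ≡⟨ ·-distribʳ-∨ y a b ⟨
    (a ∨ b) · y    ≡⟨ cong (_· y) a∨b≡e ⟩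
    e · y          ≡⟨ identityˡ y ⟩
    y              ∎

  f² : Carrier
  f² = f ²

  f≤f² : f ≤ f²
  f≤f² = square-incr f

  ∼f²≤e : ∼ f² ≤ e
  ∼f²≤e = ∼≤-swap f≤f²

  -- The residuated form of  f · f ≤ f².
  ∼f²·f≤e : ∼ f² · f ≤ e
  ∼f²·f≤e = unresiduate {∼ f²} {f} {e} (≡⇒≤ (sym (¬-involutive f²)))

  idempotent-absorbs : ∀ {b c} → b · b ≡ b → c · b ≤ e → c · b ≤ b
  idempotent-absorbs {b} {c} bb≡b cb≤e = begin
    c · b        ≡⟨ cong (c ·_) bb≡b ⟨
    c · (b · b)  ≡⟨ assoc c b b ⟨
    c · b · b    ≤⟨ ·-monoˡ cb≤e ⟩
    e · b        ≡⟨ identityˡ b ⟩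
    b            ∎

  below-∼f²-absorbs-f : ∀ {b} → b ≤ ∼ f² → f · b ≤ b
  below-∼f²-absorbs-f {b} b≤∼f² =
    idempotent-absorbs (below-e-idempotent (≤-trans b≤∼f² ∼f²≤e)) (begin
      f · b     ≤⟨ ·-monoʳ b≤∼f² ⟩
      f · ∼ f²  ≡⟨ comm f (∼ f²) ⟩
      ∼ f² · f  ≤⟨ ∼f²·f≤e ⟩
      e         ∎)

  -- Dually, elements above f² absorb f ...
  above-f²-absorbs-f : ∀ {a} → f² ≤ a → a · f ≤ a
  above-f²-absorbs-f {a} f²≤a = unresiduate (begin
    ∼ a · f  ≡⟨ comm (∼ a) f ⟩
    f · ∼ a  ≤⟨ below-∼f²-absorbs-f (∼-antitone f²≤a) ⟩
    ∼ a      ∎)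

  -- ... and are idempotent: ∼ a is idempotent and absorbs a, as a · ∼ a ≤ e.
  above-f²-idempotent : ∀ {a} → f² ≤ a → a · a ≡ a
  above-f²-idempotent {a} f²≤a = ≤-antisym (unresiduate ∼a·a≤∼a) (square-incr a)
    where
    ∼a≤∼f² : ∼ a ≤ ∼ f²
    ∼a≤∼f² = ∼-antitone f²≤a
    a·∼a≤e : a · ∼ a ≤ e
    a·∼a≤e = unresiduate (below-∼f²-absorbs-f ∼a≤∼f²)
    ∼a·a≤∼a : ∼ a · a ≤ ∼ a
    ∼a·a≤∼a = begin
      ∼ a · a  ≡⟨ comm (∼ a) a ⟩
      a · ∼ a  ≤⟨ idempotent-absorbs (below-e-idempotent (≤-trans ∼a≤∼f² ∼f²≤e)) a·∼a≤e ⟩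
      ∼ a      ∎

  interval-subuniverse : ∀ {p} → p · p ≡ p → e ≤ p → f ≤ p →
                         IsSubuniverse (λ x → ∼ p ≤ x × x ≤ p)
  interval-subuniverse {p} pp≡p e≤p f≤p =
      (∼p≤e , e≤p)
    , (λ x y (∼p≤x , x≤p) (∼p≤y , y≤p) →
           ≤-trans (≡⇒≤ (sym (below-e-idempotent ∼p≤e))) (·-mono ∼p≤x ∼p≤y)
         , ≤-trans (·-mono x≤p y≤p) (≡⇒≤ pp≡p))
    , (λ x y (∼p≤x , x≤p) (∼p≤y , y≤p) → ∧-greatest ∼p≤x ∼p≤y , ≤-trans ∧-lowerˡ x≤p)
    , (λ x y (∼p≤x , x≤p) (∼p≤y , y≤p) → ≤-trans ∼p≤x ∨-upperˡ , ∨-least x≤p y≤p)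
    , (λ x (∼p≤x , x≤p) → ∼-antitone x≤p , ∼≤-swap ∼p≤x)
    where
    ∼p≤e : ∼ p ≤ e
    ∼p≤e = ∼≤-swap f≤p

  module _ (fsi : IsFSI) where

    -- e is join-irreducible: the kernels for e ∧ a and e ∧ b meet in the
    -- identity, so one of them is the identity.
    e-join-irreducible : ∀ {a b} → e ≤ a ∨ b → e ≤ a ⊎ e ≤ b
    e-join-irreducible {a} {b} e≤a∨b =
      ⊎-map (ker-identity⇒e ∧-lowerˡ) (ker-identity⇒e ∧-lowerˡ)
        (fsi (ker (e ∧ a)) (ker (e ∧ b))
             (ker-isCongruence ∧-lowerˡ) (ker-isCongruence ∧-lowerˡ)
             (ker-meet-identity (trans (sym (∧-distribˡ-∨ e a b)) e≤a∨b)))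

    -- Every element lies above e or below f, since e ≤ b ∨ ∼ b.
    above-e-or-below-f : ∀ b → e ≤ b ⊎ b ≤ f
    above-e-or-below-f b = ⊎-map id ≤∼-swap (e-join-irreducible e≤b∨∼b)
      where
      b∧∼b≤f : b ∧ ∼ b ≤ f
      b∧∼b≤f = begin
        b ∧ ∼ b                ≤⟨ square-incr (b ∧ ∼ b) ⟩
        (b ∧ ∼ b) · (b ∧ ∼ b)  ≤⟨ ·-mono ∧-lowerˡ ∧-lowerʳ ⟩
        b · ∼ b                ≤⟨ ≤∼⇒·≤f ≤-refl ⟩
        f                      ∎
      e≤b∨∼b : e ≤ b ∨ ∼ b
      e≤b∨∼b = ∼-reflects (begin
        ∼ (b ∨ ∼ b)  ≤⟨ ∧-greatest (∼≤-swap ∨-upperʳ) (∼-antitone ∨-upperˡ) ⟩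
        b ∧ ∼ b      ≤⟨ b∧∼b≤f ⟩
        f            ∎)

    -- Every element above f² is comparable with every element c:
    -- apply the dichotomy to a · ∼ c.
    above-f²-comparable : ∀ {a} → f² ≤ a → ∀ c → c ≤ a ⊎ a ≤ c
    above-f²-comparable {a} f²≤a c =
      ⊎-map e≤a·∼c⇒c≤a (λ a·∼c≤f → ∼-reflects (·≤f⇒≤∼ a·∼c≤f)) (above-e-or-below-f (a · ∼ c))
      where
      e≤a·∼c⇒c≤a : e ≤ a · ∼ c → c ≤ a
      e≤a·∼c⇒c≤a e≤a·∼c = begin
        c              ≡⟨ identityˡ c ⟨
        e · c          ≤⟨ ·-monoˡ e≤a·∼c ⟩
        a · ∼ c · c    ≡⟨ assoc a (∼ c) c ⟩
        a · (∼ c · c)  ≤⟨ ·-monoʳ (≤∼⇒·≤f (≡⇒≤ (sym (¬-involutive c)))) ⟩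
        a · f          ≤⟨ above-f²-absorbs-f f²≤a ⟩
        a              ∎

    -- If f² ≤ e, every element is idempotent: those above e lie above
    -- f², those below f lie below e.
    f²≤e⇒idempotent : f² ≤ e → IsIdempotentAlg
    f²≤e⇒idempotent f²≤e x =
      [ (λ e≤x → above-f²-idempotent (≤-trans f²≤e e≤x))
      , (λ x≤f → below-e-idempotent (≤-trans x≤f (≤-trans f≤f² f²≤e)))
      ]′ (above-e-or-below-f x)

    -- Hence, comparing f² with e, a non-idempotent A has e ≤ f².
    e≤f² : ¬ IsIdempotentAlg → e ≤ f²
    e≤f² not-idempotent =
      [ id , (λ f²≤e → ⊥-elim (not-idempotent (f²≤e⇒idempotent f²≤e))) ]′
        (above-f²-comparable ≤-refl e)

    -- Comparing f² with x and with ∼ x places x in one of the three parts.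
    trichotomy : ∀ x → x ≤ ∼ f² ⊎ (∼ f² ≤ x × x ≤ f²) ⊎ f² ≤ x
    trichotomy x = place (above-f²-comparable ≤-refl x) (above-f²-comparable ≤-refl (∼ x))
      where
      place : x ≤ f² ⊎ f² ≤ x → ∼ x ≤ f² ⊎ f² ≤ ∼ x →
              x ≤ ∼ f² ⊎ (∼ f² ≤ x × x ≤ f²) ⊎ f² ≤ x
      place (inj₂ f²≤x) _            = inj₂ (inj₂ f²≤x)
      place (inj₁ x≤f²) (inj₁ ∼x≤f²) = inj₂ (inj₁ (∼≤-swap ∼x≤f² , x≤f²))
      place (inj₁ _)    (inj₂ f²≤∼x) = inj₁ (≤∼-swap f²≤∼x)

    -- [f²) is a chain, as its elements are comparable with everything.
    upper-chain : IsChain (λ x → f² ≤ x)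
    upper-chain x y f²≤x _ = swap (above-f²-comparable f²≤x y)

    -- ∼ maps (∼ f²] into [f²) reversing the order.
    lower-chain : IsChain (λ x → x ≤ ∼ f²)
    lower-chain x y x≤∼f² _ =
      ⊎-map ∼-reflects ∼-reflects (above-f²-comparable (≤∼-swap x≤∼f²) (∼ y))

theorem5p17 : ExcludedMiddle 0ℓ → (A : DeMorganMonoid) →
    let open DeMorganMonoid A renaming (¬_ to ∼_) in
    IsFSI → ¬ IsIdempotentAlg →
    (∀ x → x ≤ ∼ (f ²) ⊎ (∼ (f ²) ≤ x × x ≤ f ²) ⊎ f ² ≤ x)
    × IsSubuniverse (λ x → ∼ (f ²) ≤ x × x ≤ f ²)
    × IsChain (λ x → x ≤ ∼ (f ²))
    × (∀ x → x ≤ ∼ (f ²) → IsIdempotentElem x)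
    × IsChain (λ x → f ² ≤ x)
    × (∀ x → f ² ≤ x → IsIdempotentElem x)
theorem5p17 _ A fsi not-idempotent =
    trichotomy fsi
  , interval-subuniverse (above-f²-idempotent ≤-refl) (e≤f² fsi not-idempotent) f≤f²
  , lower-chain fsi
  , (λ x x≤∼f² → below-e-idempotent (≤-trans x≤∼f² ∼f²≤e))
  , upper-chain fsi
  , (λ x → above-f²-idempotent)
  where open Properties A
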